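{- Let $X=\mathcal{M}_O(n,1,b)$ with $b>3$ be feasible. Let $\mathbf{F}$ be the set of vertex sets of the $4$-cycles $[u_i,u_{i+1},v_{i+1},v_i]$ ($i$ even); let $\mathbf{M}$ be the set of $2$-element sets of endpoints of the edges of $\mathcal{G}$; and let $\mathbf{A}$ be the set of vertex sets of the cycles (anchor chains) of the auxiliary $2$-regular graph $Y$ on $V(X)$ whose edges are the edges of $\mathcal{G}$ together with the edges $[u_i,v_{i+1}]$ and $[u_{i+1},v_i]$ for all even $i$. Then $\mathbf{A}$, $\mathbf{F}$ and $\mathbf{M}$ are block systems of $\mathrm{Aut}(X)$. Moreover, if $f\in\mathrm{Aut}(X)$ fixes a vertex of an anchor chain $\mathcal{A}\in\mathbf{A}$, then $f$ fixes every vertex of $\mathcal{A}$.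
   Context: For even $n\ge4$ and odd $0<a<b<n$, $\mathcal{M}_O(n,a,b)$ has vertices $u_0,\dots,u_{n-1},v_0,\dots,v_{n-1}$ and edges $[u_i,u_{i+1}]$, $[u_i,v_i]$ for all $i$ and $[v_i,v_{i+a}]$, $[v_i,v_{i+b}]$ for even $i$ (subscripts mod $n$). For $a=1$, feasibility means $\gcd(b-1,n)=2$, $(b-1)^2/2\equiv 2\pmod n$ and $1<b-2<n-3$. Here the green edge set is $\mathcal{G}=\{[u_i,u_{i+1}]: i\text{ odd}\}\cup\{[v_j,v_{j+b}]: j\text{ even}\}$. -}

module Defs where

open import Data.Nat using (ℕ; zero; suc; _+_; _*_; _∸_; _^_; _≤_; _<_; NonZero; _%_; _/_)
open import Data.Nat.Divisibility using (_∣_)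
open import Data.Nat.GCD using (gcd)
open import Data.Nat.DivMod using (_mod_)
open import Data.Fin using (Fin; toℕ)
open import Data.Product using (Σ; ∃; _×_; _,_)
open import Data.Sum using (_⊎_)
open import Relation.Nullary using (¬_)
open import Relation.Binary.PropositionalEquality using (_≡_)
open import Relation.Binary.Construct.Closure.ReflexiveTransitive using (Star)
open import Function.Bundles using (_⇔_)

-- Vertices of M_O(n,a,b): (U , i) is u_i and (V , i) is v_i, indices in Z_n = Fin n.
data Side : Set where
  U V : Side

Vertex : ℕ → Set
Vertex n = Side × Fin n

_⊕_ : {n : ℕ} .{{_ : NonZero n}} → Fin n → ℕ → Fin n
_⊕_ {n} i k = (toℕ i + k) mod n

EvenIx : {n : ℕ} → Fin n → Set
EvenIx i = 2 ∣ toℕ i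

OddIx : {n : ℕ} → Fin n → Set
OddIx i = ¬ (2 ∣ toℕ i)

-- directed "edge from x to y" of M_O(n,a,b); adjacency is its symmetric closure
Arc : (n a b : ℕ) .{{_ : NonZero n}} → Vertex n → Vertex n → Set
Arc n a b (U , i) (U , j) = j ≡ i ⊕ 1
Arc n a b (U , i) (V , j) = j ≡ i
Arc n a b (V , i) (U , j) = Data.Empty.⊥ where import Data.Empty
Arc n a b (V , i) (V , j) = EvenIx i × (j ≡ i ⊕ a ⊎ j ≡ i ⊕ b)

Adj : (n a b : ℕ) .{{_ : NonZero n}} → Vertex n → Vertex n → Set
Adj n a b x y = Arc n a b x y ⊎ Arc n a b y x

record Aut (n a b : ℕ) .{{_ : NonZero n}} : Set where
  field
    fun     : Vertex n → Vertex n
    inv     : Vertex n → Vertex n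
    inv-l   : ∀ x → inv (fun x) ≡ x
    inv-r   : ∀ x → fun (inv x) ≡ x
    adj     : ∀ x y → Adj n a b x y ⇔ Adj n a b (fun x) (fun y)

record BlockSystem (n a b : ℕ) .{{_ : NonZero n}} (I : Set) (Mem : I → Vertex n → Set) : Set where
  field
    nonempty  : ∀ i → ∃ λ x → Mem i x
    cover     : ∀ x → ∃ λ i → Mem i x
    disjoint  : ∀ i j x → Mem i x → Mem j x → ∀ z → Mem i z ⇔ Mem j z
    invariant : (f : Aut n a b) → ∀ i → ∃ λ j → ∀ x → Mem i x ⇔ Mem j (Aut.fun f x)

Feasible1 : (n b : ℕ) .{{_ : NonZero n}} → Set
Feasible1 n b =
  gcd (b ∸ 1) n ≡ 2 ×
  ((((b ∸ 1) ^ 2) / 2) % n ≡ 2 % n) ×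
  (1 < b ∸ 2 × b ∸ 2 < n ∸ 3)

-- green edge set G: [u_i,u_{i+1}] (i odd) and [v_j,v_{j+b}] (j even)
GreenIx : ℕ → Set
GreenIx n = Σ (Side × Fin n) λ { (U , i) → OddIx i ; (V , i) → EvenIx i }

MemM : (n b : ℕ) .{{_ : NonZero n}} → GreenIx n → Vertex n → Set
MemM n b ((U , i) , _) x = x ≡ (U , i) ⊎ x ≡ (U , i ⊕ 1)
MemM n b ((V , i) , _) x = x ≡ (V , i) ⊎ x ≡ (V , i ⊕ b)

FIx : ℕ → Set
FIx n = Σ (Fin n) EvenIx

MemF : (n : ℕ) .{{_ : NonZero n}} → FIx n → Vertex n → Set
MemF n (i , _) x = x ≡ (U , i) ⊎ x ≡ (U , i ⊕ 1) ⊎ x ≡ (V , i ⊕ 1) ⊎ x ≡ (V , i)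

YArc : (n b : ℕ) .{{_ : NonZero n}} → Vertex n → Vertex n → Set
YArc n b x y =
  (Σ (GreenIx n) λ e → MemM n b e x × MemM n b e y × ¬ (x ≡ y)) ⊎
  (Σ (Fin n) λ i → EvenIx i × ((x ≡ (U , i) × y ≡ (V , i ⊕ 1)) ⊎ (x ≡ (U , i ⊕ 1) × y ≡ (V , i))))

YAdj : (n b : ℕ) .{{_ : NonZero n}} → Vertex n → Vertex n → Set
YAdj n b x y = YArc n b x y ⊎ YArc n b y x

-- A: vertex sets of the cycles (= connected components) of the 2-regular graph Y;
-- the anchor chain indexed by w is the component of Y containing w
MemA : (n b : ℕ) .{{_ : NonZero n}} → Vertex n → Vertex n → Set
MemA n b w x = Star (YAdj n b) w x

{-# OPTIONS --safe #-}
-- A green edge lies on no 4-cycle of X: such a cycle would force n to divide one of 2, 4, b − 1,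
-- b + 1 or 2(b − 1), all excluded by feasibility (the last because gcd(b − 1, n) = 2). Every other
-- edge is a side of one of the squares [u_i, u_{i+1}, v_{i+1}, v_i]. So automorphisms preserve the
-- green edges and the edges on 4-cycles, hence permute the green pairs and the squares, which are
-- the connected components of these two edge sets; and they preserve Y, whose edges join a vertex
-- to its green partner and to the opposite corner of its square. Both partners are unique, so an
-- automorphism fixing a vertex fixes its Y-neighbours, and hence its whole anchor chain.
module Submission where

open import Defs
open import Data.Nat
open import Data.Nat.Properties
open import Data.Nat.Divisibility
open import Data.Nat.DivMod
open import Data.Nat.GCD using (gcd; gcd-greatest)
open import Data.Fin using (Fin; toℕ)
open import Data.Fin.Properties using (toℕ-fromℕ<; toℕ-injective; toℕ<n)
open import Data.Product renaming (map to ×-map)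
open import Data.Product.Properties using (,-injectiveʳ)
open import Data.Empty
open import Data.Sum using (_⊎_; inj₁; inj₂) renaming (swap to ⊎-swap; map to ⊎-map)
open import Relation.Nullary
open import Relation.Binary.PropositionalEquality
open import Relation.Binary.Construct.Closure.ReflexiveTransitive using (Star; ε; _◅_; _◅◅_; gmap; reverse)
open import Relation.Binary.Rewriting using (Deterministic)
open import Function using (_∘′_)
open import Function.Bundles using (_⇔_; mk⇔; Equivalence)

2∤1 : 2 ∤ 1
2∤1 = >⇒∤ (s≤s (s≤s z≤n))

2∤m⇒2∣1+m : ∀ m → 2 ∤ m → 2 ∣ suc m
2∤m⇒2∣1+m zero          2∤0 = ⊥-elim (2∤0 (divides 0 refl))
2∤m⇒2∣1+m (suc zero)    _   = divides 1 refl
2∤m⇒2∣1+m (suc (suc m)) 2∤2+m =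
  ∣m∣n⇒∣m+n (∣-refl {2}) (2∤m⇒2∣1+m m (2∤2+m ∘′ ∣m∣n⇒∣m+n (∣-refl {2})))

2∤m⇒2∤n⇒2∣m+n : ∀ m n → 2 ∤ m → 2 ∤ n → 2 ∣ m + n
2∤m⇒2∤n⇒2∣m+n m n 2∤m 2∤n = ∣m+n∣m⇒∣n 2∣2+[m+n] (∣-refl {2})
  where
  2∣2+[m+n] : 2 ∣ 2 + (m + n)
  2∣2+[m+n] = subst (2 ∣_) (cong suc (+-suc m n)) (∣m∣n⇒∣m+n (2∤m⇒2∣1+m m 2∤m) (2∤m⇒2∣1+m n 2∤n))

2∣m⇒2∤n⇒2∤m+n : ∀ {m n} → 2 ∣ m → 2 ∤ n → 2 ∤ m + n
2∣m⇒2∤n⇒2∤m+n 2∣m 2∤n 2∣m+n = 2∤n (∣m+n∣m⇒∣n 2∣m+n 2∣m)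

2∣m⇒2∤n⇒2∤m∸n : ∀ {m n} → 2 ∣ m → 2 ∤ n → n ≤ m → 2 ∤ m ∸ n
2∣m⇒2∤n⇒2∤m∸n 2∣m 2∤n n≤m 2∣m∸n =
  2∣m⇒2∤n⇒2∤m+n 2∣m∸n 2∤n (subst (2 ∣_) (sym (m∸n+n≡m n≤m)) 2∣m)

module _ {n : ℕ} ⦃ _ : NonZero n ⦄ where

  toℕ-⊕ : ∀ (i : Fin n) k → toℕ (i ⊕ k) ≡ (toℕ i + k) % n
  toℕ-⊕ i k = toℕ-fromℕ< (m%n<n (toℕ i + k) n)

  [m%n+k]%n≡[m+k]%n : ∀ m k → (m % n + k) % n ≡ (m + k) % n
  [m%n+k]%n≡[m+k]%n m k = begin
    (m % n + k) % n         ≡⟨ %-distribˡ-+ (m % n) k n ⟩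
    (m % n % n + k % n) % n ≡⟨ cong (λ t → (t + k % n) % n) (m%n%n≡m%n m n) ⟩
    (m % n + k % n) % n     ≡⟨ %-distribˡ-+ m k n ⟨
    (m + k) % n             ∎
    where open ≡-Reasoning

  ⊕-assoc : ∀ (i : Fin n) c d → (i ⊕ c) ⊕ d ≡ i ⊕ (c + d)
  ⊕-assoc i c d = toℕ-injective (begin
    toℕ ((i ⊕ c) ⊕ d)         ≡⟨ toℕ-⊕ (i ⊕ c) d ⟩
    (toℕ (i ⊕ c) + d) % n     ≡⟨ cong (λ t → (t + d) % n) (toℕ-⊕ i c) ⟩
    ((toℕ i + c) % n + d) % n ≡⟨ [m%n+k]%n≡[m+k]%n (toℕ i + c) d ⟩
    (toℕ i + c + d) % n       ≡⟨ cong (_% n) (+-assoc (toℕ i) c d) ⟩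
    (toℕ i + (c + d)) % n     ≡⟨ toℕ-⊕ i (c + d) ⟨
    toℕ (i ⊕ (c + d))         ∎)
    where open ≡-Reasoning

  ⊕-chain : ∀ {i j : Fin n} k c d → i ≡ j ⊕ c → j ≡ k ⊕ d → i ≡ k ⊕ (d + c)
  ⊕-chain k c d refl refl = ⊕-assoc k d c

  i⊕n≡i : ∀ (i : Fin n) → i ⊕ n ≡ i
  i⊕n≡i i = toℕ-injective (begin
    toℕ (i ⊕ n)       ≡⟨ toℕ-⊕ i n ⟩
    (toℕ i + n) % n   ≡⟨ [m+n]%n≡m%n (toℕ i) n ⟩
    toℕ i % n         ≡⟨ m<n⇒m%n≡m (toℕ<n i) ⟩
    toℕ i             ∎)
    where open ≡-Reasoning

  ⊕-∸-inverseʳ : ∀ (i : Fin n) {c} → c ≤ n → (i ⊕ c) ⊕ (n ∸ c) ≡ i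
  ⊕-∸-inverseʳ i {c} c≤n = trans (⊕-assoc i c (n ∸ c)) (trans (cong (i ⊕_) (m+[n∸m]≡n c≤n)) (i⊕n≡i i))

  ⊕-∸-inverseˡ : ∀ (i : Fin n) {c} → c ≤ n → (i ⊕ (n ∸ c)) ⊕ c ≡ i
  ⊕-∸-inverseˡ i {c} c≤n = trans (⊕-assoc i (n ∸ c) c) (trans (cong (i ⊕_) (m∸n+n≡m c≤n)) (i⊕n≡i i))

  ⊕-cancelʳ : ∀ (i j : Fin n) {c} → c ≤ n → i ⊕ c ≡ j ⊕ c → i ≡ j
  ⊕-cancelʳ i j {c} c≤n eq = begin
    i                   ≡⟨ ⊕-∸-inverseʳ i c≤n ⟨
    (i ⊕ c) ⊕ (n ∸ c)   ≡⟨ cong (_⊕ (n ∸ c)) eq ⟩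
    (j ⊕ c) ⊕ (n ∸ c)   ≡⟨ ⊕-∸-inverseʳ j c≤n ⟩
    j                   ∎
    where open ≡-Reasoning

  -- Shift i to index 0 first: there the fixed-point equation reads c % n ≡ 0.
  ⊕-fixed⇒∣ : ∀ (i : Fin n) c → i ⊕ c ≡ i → n ∣ c
  ⊕-fixed⇒∣ i c eq = m%n≡0⇒n∣m c n (begin
    c % n                 ≡⟨ cong (λ t → (t + c) % n) toℕ-o ⟨
    (toℕ o + c) % n       ≡⟨ toℕ-⊕ o c ⟨
    toℕ (o ⊕ c)           ≡⟨ cong toℕ o⊕c≡o ⟩
    toℕ o                 ≡⟨ toℕ-o ⟩
    0                     ∎)
    where
    open ≡-Reasoning
    a = toℕ i
    o = i ⊕ (n ∸ a)
    toℕ-o : toℕ o ≡ 0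
    toℕ-o = trans (toℕ-⊕ i (n ∸ a)) (trans (cong (_% n) (m+[n∸m]≡n (<⇒≤ (toℕ<n i)))) (n%n≡0 n))
    o⊕c≡o : o ⊕ c ≡ o
    o⊕c≡o = begin
      (i ⊕ (n ∸ a)) ⊕ c   ≡⟨ ⊕-assoc i (n ∸ a) c ⟩
      i ⊕ (n ∸ a + c)     ≡⟨ cong (i ⊕_) (+-comm (n ∸ a) c) ⟩
      i ⊕ (c + (n ∸ a))   ≡⟨ ⊕-assoc i c (n ∸ a) ⟨
      (i ⊕ c) ⊕ (n ∸ a)   ≡⟨ cong (_⊕ (n ∸ a)) eq ⟩
      i ⊕ (n ∸ a)         ∎

  ⊕-≡⇒∣∸ : ∀ (i : Fin n) {c d} → c ≤ d → i ⊕ c ≡ i ⊕ d → n ∣ d ∸ c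
  ⊕-≡⇒∣∸ i {c} {d} c≤d eq = ⊕-fixed⇒∣ (i ⊕ c) (d ∸ c) (begin
    (i ⊕ c) ⊕ (d ∸ c)   ≡⟨ ⊕-assoc i c (d ∸ c) ⟩
    i ⊕ (c + (d ∸ c))   ≡⟨ cong (i ⊕_) (m+[n∸m]≡n c≤d) ⟩
    i ⊕ d               ≡⟨ eq ⟨
    i ⊕ c               ∎)
    where open ≡-Reasoning

  module _ (2∣n : 2 ∣ n) where

    even-⊕⇔ : ∀ (i : Fin n) k → EvenIx (i ⊕ k) ⇔ 2 ∣ toℕ i + k
    even-⊕⇔ i k = mk⇔
      (λ e → ∣n∣m%n⇒∣m 2∣n (subst (2 ∣_) (toℕ-⊕ i k) e))
      (λ e → subst (2 ∣_) (sym (toℕ-⊕ i k)) (%-presˡ-∣ e 2∣n))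

    even⊕odd : ∀ {i : Fin n} {k} → EvenIx i → 2 ∤ k → OddIx (i ⊕ k)
    even⊕odd {i} {k} ei ok = 2∣m⇒2∤n⇒2∤m+n ei ok ∘′ Equivalence.to (even-⊕⇔ i k)

    odd⊕odd : ∀ {i : Fin n} {k} → OddIx i → 2 ∤ k → EvenIx (i ⊕ k)
    odd⊕odd {i} {k} oi ok = Equivalence.from (even-⊕⇔ i k) (2∤m⇒2∤n⇒2∣m+n (toℕ i) k oi ok)

module Automorphisms {n : ℕ} ⦃ _ : NonZero n ⦄ (a b : ℕ) where

  open Aut

  Aut-inverse : Aut n a b → Aut n a b
  Aut-inverse f = record
    { fun = inv f ; inv = fun f ; inv-l = inv-r f ; inv-r = inv-l f
    ; adj = λ x y → mk⇔
        (λ x~y → Equivalence.from (adj f (inv f x) (inv f y))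
                   (subst₂ (Adj n a b) (sym (inv-r f x)) (sym (inv-r f y)) x~y))
        (λ ix~iy → subst₂ (Adj n a b) (inv-r f x) (inv-r f y)
                     (Equivalence.to (adj f (inv f x) (inv f y)) ix~iy))
    }

  fun-injective : (f : Aut n a b) → ∀ {x y} → fun f x ≡ fun f y → x ≡ y
  fun-injective f {x} {y} eq = trans (sym (inv-l f x)) (trans (cong (inv f) eq) (inv-l f y))

  Preserved : (Vertex n → Vertex n → Set) → Set
  Preserved R = ∀ (f : Aut n a b) {x y} → R x y → R (fun f x) (fun f y)

  module _ {R : Vertex n → Vertex n → Set} (R-preserved : Preserved R) where

    reflected : ∀ (f : Aut n a b) {x y} → R (fun f x) (fun f y) → R x y
    reflected f {x} {y} r = subst₂ R (inv-l f x) (inv-l f y) (R-preserved (Aut-inverse f) r)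

    Star-preserved : Preserved (Star R)
    Star-preserved f = gmap (fun f) (R-preserved f)

    Star-reflected : ∀ (f : Aut n a b) {x y} → Star R (fun f x) (fun f y) → Star R x y
    Star-reflected f {x} {y} rs = subst₂ (Star R) (inv-l f x) (inv-l f y) (Star-preserved (Aut-inverse f) rs)

    blockSystem-of-connected :
      {I : Set} (Mem : I → Vertex n → Set) →
      (∀ i → ∃ (Mem i)) → (∀ x → ∃ λ i → Mem i x) →
      (∀ {i x y} → R x y → Mem i x → Mem i y) →
      (∀ {i x y} → Mem i x → Mem i y → Star R x y) →
      BlockSystem n a b I Mem
    blockSystem-of-connected Mem nonempty cover within connected = record
      { nonempty  = nonempty
      ; cover     = cover
      ; disjoint  = λ i j x x∈i x∈j z → mk⇔ (λ z∈i → along (connected x∈i z∈i) x∈j)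
                                             (λ z∈j → along (connected x∈j z∈j) x∈i)
      ; invariant = invariant
      }
      where
      along : ∀ {i x y} → Star R x y → Mem i x → Mem i y
      along ε        x∈i = x∈i
      along (r ◅ rs) x∈i = along rs (within r x∈i)

      invariant : (f : Aut n a b) → ∀ i → ∃ λ j → ∀ x → Mem i x ⇔ Mem j (fun f x)
      invariant f i = j , λ x → mk⇔
        (λ x∈i → along (Star-preserved f (connected x₀∈i x∈i)) fx₀∈j)
        (λ fx∈j → along (Star-reflected f (connected fx₀∈j fx∈j)) x₀∈i)
        where
        x₀ = proj₁ (nonempty i)
        x₀∈i = proj₂ (nonempty i)
        j = proj₁ (cover (fun f x₀))
        fx₀∈j = proj₂ (cover (fun f x₀))

    fixed-along-Star : ∀ (f : Aut n a b) → (∀ {x y} → fun f x ≡ x → R x y → fun f y ≡ y) →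
                       ∀ {x z} → fun f x ≡ x → Star R x z → fun f z ≡ z
    fixed-along-Star f step fx ε        = fx
    fixed-along-Star f step fx (r ◅ rs) = fixed-along-Star f step (step fx r) rs

    fixed-step : Deterministic _≡_ R → ∀ (f : Aut n a b) {x y} → fun f x ≡ x → R x y → fun f y ≡ y
    fixed-step R-det f {x} {y} fx r = R-det (subst (λ t → R t (fun f y)) fx (R-preserved f r)) r

  Adj-preserved : Preserved (Adj n a b)
  Adj-preserved f {x} {y} = Equivalence.to (adj f x y)

other-endpoint-unique : ∀ {A : Set} {p q x y y′ : A} →
  x ≡ p ⊎ x ≡ q → y ≡ p ⊎ y ≡ q → y′ ≡ p ⊎ y′ ≡ q → x ≢ y → x ≢ y′ → y ≡ y′
other-endpoint-unique (inj₁ refl) (inj₁ refl) _           x≢y _    = ⊥-elim (x≢y refl)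
other-endpoint-unique (inj₁ refl) (inj₂ refl) (inj₁ refl) _   x≢y′ = ⊥-elim (x≢y′ refl)
other-endpoint-unique (inj₁ refl) (inj₂ refl) (inj₂ refl) _   _    = refl
other-endpoint-unique (inj₂ refl) (inj₂ refl) _           x≢y _    = ⊥-elim (x≢y refl)
other-endpoint-unique (inj₂ refl) (inj₁ refl) (inj₂ refl) _   x≢y′ = ⊥-elim (x≢y′ refl)
other-endpoint-unique (inj₂ refl) (inj₁ refl) (inj₁ refl) _   _    = refl

gcd≡2⇒n∤d+d : ∀ {d n} → gcd d n ≡ 2 → 2 < d → d < n → n ∤ d + d
gcd≡2⇒n∤d+d {d} gcd≡2 2<d d<n (divides zero d+d≡0) = <⇒≢ (<-trans z<s 2<d) (sym (m+n≡0⇒m≡0 d d+d≡0))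
gcd≡2⇒n∤d+d {d} {n} gcd≡2 2<d d<n (divides 1 d+d≡n) =
  <⇒≱ 2<d (∣⇒≤ (subst (d ∣_) gcd≡2 (gcd-greatest ∣-refl d∣n)))
  where
  d∣n : d ∣ n
  d∣n = divides 2 (trans (sym (trans d+d≡n (+-identityʳ n))) (cong (d +_) (sym (+-identityʳ d))))
gcd≡2⇒n∤d+d {d} {n} gcd≡2 2<d d<n (divides (suc (suc q)) d+d≡[2+q]n) =
  <⇒≱ (+-mono-< d<n d<n) (subst (n + n ≤_) (sym d+d≡[2+q]n) (+-monoʳ-≤ n (m≤m+n n (q * n))))

[m+m]∸2≡[m∸1]+[m∸1] : ∀ {m} → 1 ≤ m → (m + m) ∸ 2 ≡ (m ∸ 1) + (m ∸ 1)
[m+m]∸2≡[m∸1]+[m∸1] {suc m} _ = cong (_∸ 1) (+-suc m m)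

m∸2<n∸3⇒1+m<n : ∀ {m n} → 2 ≤ m → 3 ≤ n → m ∸ 2 < n ∸ 3 → suc m < n
m∸2<n∸3⇒1+m<n (s≤s (s≤s _)) (s≤s (s≤s (s≤s _))) lt = s≤s (s≤s (s≤s lt))

0<m<n⇒n∤m : ∀ {m n} → 0 < m → m < n → n ∤ m
0<m<n⇒n∤m {suc m} _ m<n n∣m = <⇒≱ m<n (∣⇒≤ n∣m)

module MO₁ (n b : ℕ) ⦃ _ : NonZero n ⦄ (2∣n : 2 ∣ n) (2∤b : 2 ∤ b) (3<b : 3 < b) (1+b<n : suc b < n)
           (n∤2b∸2 : n ∤ (b + b) ∸ 2) where

  open Automorphisms {n} 1 b

  infix 4 _~_
  _~_ : Vertex n → Vertex n → Set
  _~_ = Adj n 1 b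

  ~-sym : ∀ {x y} → x ~ y → y ~ x
  ~-sym = ⊎-swap

  1≤b : 1 ≤ b
  1≤b = ≤-trans (s≤s z≤n) 3<b

  b<n : b < n
  b<n = ≤-trans (n≤1+n (suc b)) 1+b<n

  b+1<n : b + 1 < n
  b+1<n = subst (_< n) (+-comm 1 b) 1+b<n

  0<b+1 : 0 < b + 1
  0<b+1 = m≤n+m 1 b

  4<n : 4 < n
  4<n = ≤-trans (s≤s 3<b) (<⇒≤ 1+b<n)

  2<n : 2 < n
  2<n = ≤-trans (s≤s (s≤s (s≤s z≤n))) (<⇒≤ 4<n)

  1<n : 1 < n
  1<n = ≤-trans (s≤s (s≤s z≤n)) (<⇒≤ 2<n)

  1≤n : 1 ≤ n
  1≤n = <⇒≤ 1<n

  aperiodic : ∀ (i : Fin n) {c} → 0 < c → c < n → i ≢ i ⊕ c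
  aperiodic i 0<c c<n eq = 0<m<n⇒n∤m 0<c c<n (⊕-fixed⇒∣ i _ (sym eq))

  even≢even⊕1 : ∀ {i j : Fin n} → EvenIx i → EvenIx j → i ≢ j ⊕ 1
  even≢even⊕1 ei ej i≡j⊕1 = even⊕odd 2∣n ej 2∤1 (subst EvenIx i≡j⊕1 ei)

  even≢even⊕b : ∀ {i j : Fin n} → EvenIx i → EvenIx j → i ≢ j ⊕ b
  even≢even⊕b ei ej i≡j⊕b = even⊕odd 2∣n ej 2∤b (subst EvenIx i≡j⊕b ei)

  ⊕1≢⊕b : ∀ (i : Fin n) → i ⊕ 1 ≢ i ⊕ b
  ⊕1≢⊕b i eq = 0<m<n⇒n∤m (m<n⇒0<n∸m (<-trans (s≤s (s≤s z≤n)) 3<b)) (≤-<-trans (m∸n≤m b 1) b<n)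
                         (⊕-≡⇒∣∸ i 1≤b eq)

  U-neighbour : ∀ {i p} → (U , i) ~ p →
    p ≡ (U , i ⊕ 1) ⊎ p ≡ (V , i) ⊎ ∃ λ j → i ≡ j ⊕ 1 × p ≡ (U , j)
  U-neighbour {p = U , j} (inj₁ refl) = inj₁ refl
  U-neighbour {p = V , j} (inj₁ refl) = inj₂ (inj₁ refl)
  U-neighbour {p = U , j} (inj₂ i≡j⊕1) = inj₂ (inj₂ (j , i≡j⊕1 , refl))
  U-neighbour {p = V , j} (inj₂ ())

  V-neighbour : ∀ {i p} → (V , i) ~ p →
    p ≡ (U , i) ⊎ (EvenIx i × (p ≡ (V , i ⊕ 1) ⊎ p ≡ (V , i ⊕ b))) ⊎
    ∃ λ j → EvenIx j × (i ≡ j ⊕ 1 ⊎ i ≡ j ⊕ b) × p ≡ (V , j)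
  V-neighbour {p = U , j} (inj₁ ())
  V-neighbour {p = V , j} (inj₁ (ei , inj₁ refl)) = inj₂ (inj₁ (ei , inj₁ refl))
  V-neighbour {p = V , j} (inj₁ (ei , inj₂ refl)) = inj₂ (inj₁ (ei , inj₂ refl))
  V-neighbour {p = U , j} (inj₂ refl) = inj₁ refl
  V-neighbour {p = V , j} (inj₂ (ej , i≡j⊕c)) = inj₂ (inj₂ (j , ej , i≡j⊕c , refl))

  OnFourCycle : Vertex n → Vertex n → Set
  OnFourCycle x y = ∃₂ λ p q → x ~ p × p ~ q × q ~ y × x ≢ q × p ≢ y

  OnFourCycle-sym : ∀ {x y} → OnFourCycle x y → OnFourCycle y x
  OnFourCycle-sym (p , q , x~p , p~q , q~y , x≢q , p≢y) =
    q , p , ~-sym q~y , ~-sym p~q , ~-sym x~p , p≢y ∘′ sym , x≢q ∘′ sym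

  OnFourCycle-preserved : Preserved OnFourCycle
  OnFourCycle-preserved f (p , q , x~p , p~q , q~y , x≢q , p≢y) =
    fun f p , fun f q , Adj-preserved f x~p , Adj-preserved f p~q , Adj-preserved f q~y ,
    x≢q ∘′ fun-injective f , p≢y ∘′ fun-injective f
    where open Aut

  odd-rim-not-on-four-cycle : ∀ {i : Fin n} → OddIx i → ¬ OnFourCycle (U , i) (U , i ⊕ 1)
  odd-rim-not-on-four-cycle {i} oi (p , q , x~p , p~q , q~y , x≢q , p≢y) with U-neighbour x~p
  ... | inj₁ refl                   = p≢y refl
  ... | inj₂ (inj₁ refl)            = through-spoke p~q q~y x≢q
    where
    through-spoke : ∀ {q} → (V , i) ~ q → q ~ (U , i ⊕ 1) → (U , i) ≢ q → ⊥
    through-spoke v~q q~y x≢q with V-neighbour v~q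
    ... | inj₁ refl = x≢q refl
    ... | inj₂ (inj₁ (ei , _)) = oi ei
    ... | inj₂ (inj₂ (j , _ , i≡j⊕c , refl)) with V-neighbour q~y
    ...   | inj₂ (inj₁ (_ , inj₁ ()))
    ...   | inj₂ (inj₁ (_ , inj₂ ()))
    ...   | inj₂ (inj₂ (_ , _ , _ , ()))
    ...   | inj₁ e with i≡j⊕c
    ...     | inj₁ i≡j⊕1 = aperiodic i (s≤s z≤n) 2<n (⊕-chain i 1 1 i≡j⊕1 (sym (,-injectiveʳ e)))
    ...     | inj₂ i≡j⊕b = aperiodic i (s≤s z≤n) 1+b<n (⊕-chain i b 1 i≡j⊕b (sym (,-injectiveʳ e)))
  ... | inj₂ (inj₂ (j , i≡j⊕1 , refl)) = through-rim p~q q~y x≢q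
    where
    through-rim : ∀ {q} → (U , j) ~ q → q ~ (U , i ⊕ 1) → (U , i) ≢ q → ⊥
    through-rim u~q q~y x≢q with U-neighbour u~q
    ... | inj₁ refl = x≢q (cong (U ,_) i≡j⊕1)
    ... | inj₂ (inj₁ refl) with V-neighbour q~y
    ...   | inj₂ (inj₁ (_ , inj₁ ()))
    ...   | inj₂ (inj₁ (_ , inj₂ ()))
    ...   | inj₂ (inj₂ (_ , _ , _ , ()))
    ...   | inj₁ e = aperiodic i (s≤s z≤n) 2<n (⊕-chain i 1 1 i≡j⊕1 (sym (,-injectiveʳ e)))
    through-rim u~q q~y x≢q | inj₂ (inj₂ (k , j≡k⊕1 , refl)) with U-neighbour {k} {U , i ⊕ 1} q~y
    ... | inj₂ (inj₁ ())
    ... | inj₁ e = aperiodic i (s≤s z≤n) 2<n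
                     (⊕-chain i 1 1 i≡j⊕1 (trans j≡k⊕1 (cong (_⊕ 1) (⊕-cancelʳ k i 1≤n (sym (,-injectiveʳ e))))))
    ... | inj₂ (inj₂ (l , k≡l⊕1 , e)) = aperiodic i (s≤s z≤n) 4<n
                     (⊕-chain i 3 1 (⊕-chain l 2 1 (⊕-chain k 1 1 i≡j⊕1 j≡k⊕1) k≡l⊕1) (sym (,-injectiveʳ e)))

  crossed-chords : ∀ {i j : Fin n} → i ⊕ 1 ≡ j ⊕ b → j ⊕ 1 ≡ i ⊕ b → ⊥
  crossed-chords {i} {j} i⊕1≡j⊕b j⊕1≡i⊕b = n∤2b∸2 (⊕-≡⇒∣∸ j 2≤b+b (begin
    j ⊕ 2         ≡⟨ ⊕-assoc j 1 1 ⟨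
    (j ⊕ 1) ⊕ 1   ≡⟨ cong (_⊕ 1) j⊕1≡i⊕b ⟩
    (i ⊕ b) ⊕ 1   ≡⟨ ⊕-assoc i b 1 ⟩
    i ⊕ (b + 1)   ≡⟨ cong (i ⊕_) (+-comm b 1) ⟩
    i ⊕ (1 + b)   ≡⟨ ⊕-assoc i 1 b ⟨
    (i ⊕ 1) ⊕ b   ≡⟨ cong (_⊕ b) i⊕1≡j⊕b ⟩
    (j ⊕ b) ⊕ b   ≡⟨ ⊕-assoc j b b ⟩
    j ⊕ (b + b)   ∎))
    where
    open ≡-Reasoning
    2≤b+b : 2 ≤ b + b
    2≤b+b = ≤-trans (≤-trans (s≤s (s≤s z≤n)) (<⇒≤ 3<b)) (m≤m+n b b)

  long-chord-not-on-four-cycle : ∀ {i : Fin n} → EvenIx i → ¬ OnFourCycle (V , i) (V , i ⊕ b)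
  long-chord-not-on-four-cycle {i} ei = no-cycle
    where
    odd-spoke-misses-y : ¬ (U , i ⊕ 1) ~ (V , i ⊕ b)
    odd-spoke-misses-y u~y with U-neighbour {i ⊕ 1} {V , i ⊕ b} u~y
    ... | inj₂ (inj₁ e) = ⊕1≢⊕b i (sym (,-injectiveʳ e))

    through-spoke : ∀ {q} → (U , i) ~ q → q ~ (V , i ⊕ b) → (V , i) ≢ q → ⊥
    through-spoke u~q q~y x≢q with U-neighbour u~q
    ... | inj₁ refl        = odd-spoke-misses-y q~y
    ... | inj₂ (inj₁ refl) = x≢q refl
    ... | inj₂ (inj₂ (j , i≡j⊕1 , refl)) with U-neighbour {j} {V , i ⊕ b} q~y
    ...   | inj₂ (inj₁ e) = aperiodic i 0<b+1 b+1<n (⊕-chain i 1 b i≡j⊕1 (sym (,-injectiveʳ e)))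

    through-chord : ∀ {q} → (V , i ⊕ 1) ~ q → q ~ (V , i ⊕ b) → (V , i) ≢ q → ⊥
    through-chord v~q q~y x≢q with V-neighbour v~q
    ... | inj₁ refl              = odd-spoke-misses-y q~y
    ... | inj₂ (inj₁ (ei⊕1 , _)) = even⊕odd 2∣n ei 2∤1 ei⊕1
    ... | inj₂ (inj₂ (j , ej , i⊕1≡j⊕c , refl)) with V-neighbour {j} {V , i ⊕ b} q~y
    ...   | inj₂ (inj₂ (k , ek , _ , e)) = even≢even⊕b ek ei (sym (,-injectiveʳ e))
    ...   | inj₂ (inj₁ (_ , y≡j⊕c)) with i⊕1≡j⊕c | y≡j⊕c
    ...     | inj₁ i⊕1≡j⊕1 | inj₁ y≡j⊕1 =
              ⊕1≢⊕b i (trans (cong (_⊕ 1) (⊕-cancelʳ i j 1≤n i⊕1≡j⊕1)) (sym (,-injectiveʳ y≡j⊕1)))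
    ...     | inj₁ i⊕1≡j⊕1 | inj₂ _     = x≢q (cong (V ,_) (⊕-cancelʳ i j 1≤n i⊕1≡j⊕1))
    ...     | inj₂ i⊕1≡j⊕b | inj₂ y≡j⊕b =
              ⊕1≢⊕b i (trans i⊕1≡j⊕b (cong (_⊕ b) (sym (⊕-cancelʳ i j (<⇒≤ b<n) (,-injectiveʳ y≡j⊕b)))))
    ...     | inj₂ i⊕1≡j⊕b | inj₁ y≡j⊕1 = crossed-chords i⊕1≡j⊕b (sym (,-injectiveʳ y≡j⊕1))

    no-cycle : ¬ OnFourCycle (V , i) (V , i ⊕ b)
    no-cycle (p , q , x~p , p~q , q~y , x≢q , p≢y) with V-neighbour x~p
    ... | inj₁ refl                                 = through-spoke p~q q~y x≢q
    ... | inj₂ (inj₁ (_ , inj₁ refl))               = through-chord p~q q~y x≢q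
    ... | inj₂ (inj₁ (_ , inj₂ refl))               = p≢y refl
    ... | inj₂ (inj₂ (j , ej , inj₁ i≡j⊕1 , refl)) = even≢even⊕1 ei ej i≡j⊕1
    ... | inj₂ (inj₂ (j , ej , inj₂ i≡j⊕b , refl)) = even≢even⊕b ei ej i≡j⊕b

  first second : GreenIx n → Vertex n
  first = proj₁
  second ((U , i) , _) = (U , i ⊕ 1)
  second ((V , i) , _) = (V , i ⊕ b)

  MemM-endpoints : ∀ e {x} → MemM n b e x → x ≡ first e ⊎ x ≡ second e
  MemM-endpoints ((U , _) , _) x∈e = x∈e
  MemM-endpoints ((V , _) , _) x∈e = x∈e

  endpoints-MemM : ∀ e {x} → x ≡ first e ⊎ x ≡ second e → MemM n b e x
  endpoints-MemM ((U , _) , _) x∈e = x∈e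
  endpoints-MemM ((V , _) , _) x∈e = x∈e

  first≢second : ∀ e e′ → first e ≢ second e′
  first≢second ((U , i) , oi) ((U , j) , oj) eq = oi (subst EvenIx (sym (,-injectiveʳ eq)) (odd⊕odd 2∣n oj 2∤1))
  first≢second ((V , i) , ei) ((V , j) , ej) eq = even≢even⊕b ei ej (,-injectiveʳ eq)

  second-injective : ∀ e e′ → second e ≡ second e′ → first e ≡ first e′
  second-injective ((U , i) , _) ((U , j) , _) eq = cong (U ,_) (⊕-cancelʳ i j 1≤n (,-injectiveʳ eq))
  second-injective ((V , i) , _) ((V , j) , _) eq = cong (V ,_) (⊕-cancelʳ i j (<⇒≤ b<n) (,-injectiveʳ eq))

  first~second : ∀ e → first e ~ second e
  first~second ((U , _) , _)  = inj₁ refl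
  first~second ((V , _) , ei) = inj₁ (ei , inj₂ refl)

  first-second-not-on-four-cycle : ∀ e → ¬ OnFourCycle (first e) (second e)
  first-second-not-on-four-cycle ((U , _) , oi) = odd-rim-not-on-four-cycle oi
  first-second-not-on-four-cycle ((V , _) , ei) = long-chord-not-on-four-cycle ei

  MemM-same-edge : ∀ e e′ {x} → MemM n b e x → MemM n b e′ x → first e ≡ first e′
  MemM-same-edge e e′ x∈e x∈e′ with MemM-endpoints e x∈e | MemM-endpoints e′ x∈e′
  ... | inj₁ refl | inj₁ eq = eq
  ... | inj₁ refl | inj₂ eq = ⊥-elim (first≢second e e′ eq)
  ... | inj₂ refl | inj₁ eq = ⊥-elim (first≢second e′ e (sym eq))
  ... | inj₂ refl | inj₂ eq = second-injective e e′ eq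

  MemM-transfer : ∀ e e′ {z} → first e ≡ first e′ → MemM n b e z → MemM n b e′ z
  MemM-transfer ((U , i) , _) ((U , .i) , _) refl z∈e = z∈e
  MemM-transfer ((V , i) , _) ((V , .i) , _) refl z∈e = z∈e

  green-cover : ∀ x → ∃ λ e → MemM n b e x
  green-cover (U , i) with 2 ∣? toℕ i
  ... | no oi  = ((U , i) , oi) , inj₁ refl
  ... | yes ei = ((U , i ⊕ (n ∸ 1)) , even⊕odd 2∣n ei (2∣m⇒2∤n⇒2∤m∸n 2∣n 2∤1 1≤n)) ,
                 inj₂ (cong (U ,_) (sym (⊕-∸-inverseˡ i 1≤n)))
  green-cover (V , i) with 2 ∣? toℕ i
  ... | yes ei = ((V , i) , ei) , inj₁ refl
  ... | no oi  = ((V , i ⊕ (n ∸ b)) , odd⊕odd 2∣n oi (2∣m⇒2∤n⇒2∤m∸n 2∣n 2∤b (<⇒≤ b<n))) ,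
                 inj₂ (cong (V ,_) (sym (⊕-∸-inverseˡ i (<⇒≤ b<n))))

  Green : Vertex n → Vertex n → Set
  Green x y = Σ (GreenIx n) λ e → MemM n b e x × MemM n b e y × x ≢ y

  Green-sym : ∀ {x y} → Green x y → Green y x
  Green-sym (e , x∈e , y∈e , x≢y) = e , y∈e , x∈e , x≢y ∘′ sym

  Green-first-second : ∀ e → Green (first e) (second e)
  Green-first-second e = e , endpoints-MemM e (inj₁ refl) , endpoints-MemM e (inj₂ refl) , first≢second e e

  Green-edge : ∀ {x y} → Green x y → ∃ λ e → (x , y) ≡ (first e , second e) ⊎ (y , x) ≡ (first e , second e)
  Green-edge (e , x∈e , y∈e , x≢y) with MemM-endpoints e x∈e | MemM-endpoints e y∈e
  ... | inj₁ refl | inj₁ refl = ⊥-elim (x≢y refl)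
  ... | inj₁ refl | inj₂ refl = e , inj₁ refl
  ... | inj₂ refl | inj₁ refl = e , inj₂ refl
  ... | inj₂ refl | inj₂ refl = ⊥-elim (x≢y refl)

  Green-adjacent : ∀ {x y} → Green x y → x ~ y
  Green-adjacent g with Green-edge g
  ... | e , inj₁ refl = first~second e
  ... | e , inj₂ refl = ~-sym (first~second e)

  Green-not-on-four-cycle : ∀ {x y} → Green x y → ¬ OnFourCycle x y
  Green-not-on-four-cycle g with Green-edge g
  ... | e , inj₁ refl = first-second-not-on-four-cycle e
  ... | e , inj₂ refl = first-second-not-on-four-cycle e ∘′ OnFourCycle-sym

  Green-deterministic : Deterministic _≡_ Green
  Green-deterministic (e , x∈e , y∈e , x≢y) (e′ , x∈e′ , y′∈e′ , x≢y′) =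
    other-endpoint-unique (MemM-endpoints e x∈e) (MemM-endpoints e y∈e)
      (MemM-endpoints e (MemM-transfer e′ e (MemM-same-edge e′ e x∈e′ x∈e) y′∈e′)) x≢y x≢y′

  SameSquare : Vertex n → Vertex n → Set
  SameSquare x y = ∃ λ k → MemF n k x × MemF n k y

  SameSquare-sym : ∀ {x y} → SameSquare x y → SameSquare y x
  SameSquare-sym (k , x∈k , y∈k) = k , y∈k , x∈k

  MemF-same-square : ∀ (k k′ : FIx n) {x} → MemF n k x → MemF n k′ x → proj₁ k ≡ proj₁ k′
  MemF-same-square (i , ei) (j , ej) (inj₁ refl) (inj₁ e) = ,-injectiveʳ e
  MemF-same-square (i , ei) (j , ej) (inj₁ refl) (inj₂ (inj₁ e)) = ⊥-elim (even≢even⊕1 ei ej (,-injectiveʳ e))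
  MemF-same-square (i , ei) (j , ej) (inj₁ refl) (inj₂ (inj₂ (inj₁ ())))
  MemF-same-square (i , ei) (j , ej) (inj₁ refl) (inj₂ (inj₂ (inj₂ ())))
  MemF-same-square (i , ei) (j , ej) (inj₂ (inj₁ refl)) (inj₁ e) = ⊥-elim (even≢even⊕1 ej ei (sym (,-injectiveʳ e)))
  MemF-same-square (i , ei) (j , ej) (inj₂ (inj₁ refl)) (inj₂ (inj₁ e)) = ⊕-cancelʳ i j 1≤n (,-injectiveʳ e)
  MemF-same-square (i , ei) (j , ej) (inj₂ (inj₁ refl)) (inj₂ (inj₂ (inj₁ ())))
  MemF-same-square (i , ei) (j , ej) (inj₂ (inj₁ refl)) (inj₂ (inj₂ (inj₂ ())))
  MemF-same-square (i , ei) (j , ej) (inj₂ (inj₂ (inj₁ refl))) (inj₂ (inj₂ (inj₁ e))) =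
    ⊕-cancelʳ i j 1≤n (,-injectiveʳ e)
  MemF-same-square (i , ei) (j , ej) (inj₂ (inj₂ (inj₁ refl))) (inj₂ (inj₂ (inj₂ e))) =
    ⊥-elim (even≢even⊕1 ej ei (sym (,-injectiveʳ e)))
  MemF-same-square (i , ei) (j , ej) (inj₂ (inj₂ (inj₂ refl))) (inj₂ (inj₂ (inj₁ e))) =
    ⊥-elim (even≢even⊕1 ei ej (,-injectiveʳ e))
  MemF-same-square (i , ei) (j , ej) (inj₂ (inj₂ (inj₂ refl))) (inj₂ (inj₂ (inj₂ e))) = ,-injectiveʳ e

  MemF-transfer : ∀ (k k′ : FIx n) {z} → proj₁ k ≡ proj₁ k′ → MemF n k z → MemF n k′ z
  MemF-transfer (i , _) (.i , _) refl z∈k = z∈k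

  odd-predecessor : ∀ {i : Fin n} → OddIx i → ∃ λ k → EvenIx k × i ≡ k ⊕ 1
  odd-predecessor {i} oi =
    i ⊕ (n ∸ 1) , odd⊕odd 2∣n oi (2∣m⇒2∤n⇒2∤m∸n 2∣n 2∤1 1≤n) , sym (⊕-∸-inverseˡ i 1≤n)

  square-cover : ∀ x → ∃ λ k → MemF n k x
  square-cover (U , i) with 2 ∣? toℕ i
  ... | yes ei = (i , ei) , inj₁ refl
  ... | no oi with odd-predecessor oi
  ...   | k , ek , refl = (k , ek) , inj₂ (inj₁ refl)
  square-cover (V , i) with 2 ∣? toℕ i
  ... | yes ei = (i , ei) , inj₂ (inj₂ (inj₂ refl))
  ... | no oi with odd-predecessor oi
  ...   | k , ek , refl = (k , ek) , inj₂ (inj₂ (inj₁ refl))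

  module _ {i : Fin n} (ei : EvenIx i) where

    rim-on-four-cycle : OnFourCycle (U , i) (U , i ⊕ 1)
    rim-on-four-cycle = (V , i) , (V , i ⊕ 1) , inj₁ refl , inj₁ (ei , inj₁ refl) , inj₂ refl , (λ ()) , (λ ())

    spoke-on-four-cycle : OnFourCycle (U , i) (V , i)
    spoke-on-four-cycle = (U , i ⊕ 1) , (V , i ⊕ 1) , inj₁ refl , inj₁ refl , inj₂ (ei , inj₁ refl) , (λ ()) , (λ ())

    spoke⁺-on-four-cycle : OnFourCycle (U , i ⊕ 1) (V , i ⊕ 1)
    spoke⁺-on-four-cycle = (U , i) , (V , i) , inj₂ refl , inj₁ refl , inj₁ (ei , inj₁ refl) , (λ ()) , (λ ())

    chord-on-four-cycle : OnFourCycle (V , i) (V , i ⊕ 1)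
    chord-on-four-cycle = (U , i) , (U , i ⊕ 1) , inj₂ refl , inj₁ refl , inj₁ refl , (λ ()) , (λ ())

  arc-kind : ∀ {x y} → Arc n 1 b x y → Green x y ⊎ (SameSquare x y × OnFourCycle x y)
  arc-kind {U , i} {U , _} refl with 2 ∣? toℕ i
  ... | no oi  = inj₁ (Green-first-second ((U , i) , oi))
  ... | yes ei = inj₂ (((i , ei) , inj₁ refl , inj₂ (inj₁ refl)) , rim-on-four-cycle ei)
  arc-kind {U , i} {V , _} refl with 2 ∣? toℕ i
  ... | yes ei = inj₂ (((i , ei) , inj₁ refl , inj₂ (inj₂ (inj₂ refl))) , spoke-on-four-cycle ei)
  ... | no oi with odd-predecessor oi
  ...   | k , ek , refl = inj₂ (((k , ek) , inj₂ (inj₁ refl) , inj₂ (inj₂ (inj₁ refl))) , spoke⁺-on-four-cycle ek)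
  arc-kind {V , i} {V , _} (ei , inj₁ refl) =
    inj₂ (((i , ei) , inj₂ (inj₂ (inj₂ refl)) , inj₂ (inj₂ (inj₁ refl))) , chord-on-four-cycle ei)
  arc-kind {V , i} {V , _} (ei , inj₂ refl) = inj₁ (Green-first-second ((V , i) , ei))

  edge-kind : ∀ {x y} → x ~ y → Green x y ⊎ (SameSquare x y × OnFourCycle x y)
  edge-kind (inj₁ x→y) = arc-kind x→y
  edge-kind (inj₂ y→x) = ⊎-map Green-sym (×-map SameSquare-sym OnFourCycle-sym) (arc-kind y→x)

  CycleEdge : Vertex n → Vertex n → Set
  CycleEdge x y = x ~ y × OnFourCycle x y

  CycleEdge-sym : ∀ {x y} → CycleEdge x y → CycleEdge y x
  CycleEdge-sym = ×-map ~-sym OnFourCycle-sym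

  CycleEdge-preserved : Preserved CycleEdge
  CycleEdge-preserved f = ×-map (Adj-preserved f) (OnFourCycle-preserved f)

  CycleEdge-within : ∀ {k x y} → CycleEdge x y → MemF n k x → MemF n k y
  CycleEdge-within {k} (x~y , c) x∈k with edge-kind x~y
  ... | inj₁ g = ⊥-elim (Green-not-on-four-cycle g c)
  ... | inj₂ ((k′ , x∈k′ , y∈k′) , _) = MemF-transfer k′ k (MemF-same-square k′ k x∈k′ x∈k) y∈k′

  square-connected : ∀ {k x y} → MemF n k x → MemF n k y → Star CycleEdge x y
  square-connected {k} x∈k y∈k = reverse CycleEdge-sym (from-corner {k} x∈k) ◅◅ from-corner {k} y∈k
    where
    from-corner : ∀ {k x} → MemF n k x → Star CycleEdge (U , proj₁ k) x
    from-corner                (inj₁ refl)               = ε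
    from-corner {_ , ei} (inj₂ (inj₁ refl))        = (inj₁ refl , rim-on-four-cycle ei) ◅ ε
    from-corner {_ , ei} (inj₂ (inj₂ (inj₁ refl))) =
      (inj₁ refl , rim-on-four-cycle ei) ◅ (inj₁ refl , spoke⁺-on-four-cycle ei) ◅ ε
    from-corner {_ , ei} (inj₂ (inj₂ (inj₂ refl))) = (inj₁ refl , spoke-on-four-cycle ei) ◅ ε

  F-blockSystem : BlockSystem n 1 b (FIx n) (MemF n)
  F-blockSystem = blockSystem-of-connected CycleEdge-preserved (MemF n)
    (λ (i , _) → (U , i) , inj₁ refl) square-cover
    (λ {k} → CycleEdge-within {k}) (λ {k} → square-connected {k})

  SameSquare-preserved : Preserved SameSquare
  SameSquare-preserved f {x} {y} (k , x∈k , y∈k) =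
    k′ , Equivalence.to (k↦k′ x) x∈k , Equivalence.to (k↦k′ y) y∈k
    where
    k′ = proj₁ (BlockSystem.invariant F-blockSystem f k)
    k↦k′ = proj₂ (BlockSystem.invariant F-blockSystem f k)

  Green-preserved : Preserved Green
  Green-preserved f g with edge-kind (Adj-preserved f (Green-adjacent g))
  ... | inj₁ g′      = g′
  ... | inj₂ (_ , c) = ⊥-elim (Green-not-on-four-cycle g (reflected OnFourCycle-preserved f c))

  M-blockSystem : BlockSystem n 1 b (GreenIx n) (MemM n b)
  M-blockSystem = blockSystem-of-connected Green-preserved (MemM n b)
    (λ e → first e , endpoints-MemM e (inj₁ refl)) green-cover within connected
    where
    within : ∀ {e x y} → Green x y → MemM n b e x → MemM n b e y
    within {e} (e′ , x∈e′ , y∈e′ , _) x∈e = MemM-transfer e′ e (MemM-same-edge e′ e x∈e′ x∈e) y∈e′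

    connected : ∀ {e x y} → MemM n b e x → MemM n b e y → Star Green x y
    connected {e} x∈e y∈e with MemM-endpoints e x∈e | MemM-endpoints e y∈e
    ... | inj₁ refl | inj₁ refl = ε
    ... | inj₁ refl | inj₂ refl = Green-first-second e ◅ ε
    ... | inj₂ refl | inj₁ refl = Green-sym (Green-first-second e) ◅ ε
    ... | inj₂ refl | inj₂ refl = ε

  Opposite : Vertex n → Vertex n → Set
  Opposite x y = SameSquare x y × ¬ x ~ y × x ≢ y

  Opposite-sym : ∀ {x y} → Opposite x y → Opposite y x
  Opposite-sym (s , x≁y , x≢y) = SameSquare-sym s , x≁y ∘′ ~-sym , x≢y ∘′ sym

  opposite : ∀ (k : FIx n) {x} → MemF n k x → Vertex n
  opposite (i , _) (inj₁ _)               = (V , i ⊕ 1)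
  opposite (i , _) (inj₂ (inj₁ _))        = (V , i)
  opposite (i , _) (inj₂ (inj₂ (inj₁ _))) = (U , i)
  opposite (i , _) (inj₂ (inj₂ (inj₂ _))) = (U , i ⊕ 1)

  opposite-unique : ∀ k {x y} (x∈k : MemF n k x) → MemF n k y → ¬ x ~ y → x ≢ y → y ≡ opposite k x∈k
  opposite-unique (i , ei) (inj₁ refl)               (inj₁ refl)               _   x≢y = ⊥-elim (x≢y refl)
  opposite-unique (i , ei) (inj₁ refl)               (inj₂ (inj₁ refl))        x≁y _   = ⊥-elim (x≁y (inj₁ refl))
  opposite-unique (i , ei) (inj₁ refl)               (inj₂ (inj₂ (inj₁ refl))) _   _   = refl
  opposite-unique (i , ei) (inj₁ refl)               (inj₂ (inj₂ (inj₂ refl))) x≁y _   = ⊥-elim (x≁y (inj₁ refl))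
  opposite-unique (i , ei) (inj₂ (inj₁ refl))        (inj₁ refl)               x≁y _   = ⊥-elim (x≁y (inj₂ refl))
  opposite-unique (i , ei) (inj₂ (inj₁ refl))        (inj₂ (inj₁ refl))        _   x≢y = ⊥-elim (x≢y refl)
  opposite-unique (i , ei) (inj₂ (inj₁ refl))        (inj₂ (inj₂ (inj₁ refl))) x≁y _   = ⊥-elim (x≁y (inj₁ refl))
  opposite-unique (i , ei) (inj₂ (inj₁ refl))        (inj₂ (inj₂ (inj₂ refl))) _   _   = refl
  opposite-unique (i , ei) (inj₂ (inj₂ (inj₁ refl))) (inj₁ refl)               _   _   = refl
  opposite-unique (i , ei) (inj₂ (inj₂ (inj₁ refl))) (inj₂ (inj₁ refl))        x≁y _   = ⊥-elim (x≁y (inj₂ refl))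
  opposite-unique (i , ei) (inj₂ (inj₂ (inj₁ refl))) (inj₂ (inj₂ (inj₁ refl))) _   x≢y = ⊥-elim (x≢y refl)
  opposite-unique (i , ei) (inj₂ (inj₂ (inj₁ refl))) (inj₂ (inj₂ (inj₂ refl))) x≁y _   =
    ⊥-elim (x≁y (inj₂ (ei , inj₁ refl)))
  opposite-unique (i , ei) (inj₂ (inj₂ (inj₂ refl))) (inj₁ refl)               x≁y _   = ⊥-elim (x≁y (inj₂ refl))
  opposite-unique (i , ei) (inj₂ (inj₂ (inj₂ refl))) (inj₂ (inj₁ refl))        _   _   = refl
  opposite-unique (i , ei) (inj₂ (inj₂ (inj₂ refl))) (inj₂ (inj₂ (inj₁ refl))) x≁y _   =
    ⊥-elim (x≁y (inj₁ (ei , inj₁ refl)))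
  opposite-unique (i , ei) (inj₂ (inj₂ (inj₂ refl))) (inj₂ (inj₂ (inj₂ refl))) _   x≢y = ⊥-elim (x≢y refl)

  Opposite-deterministic : Deterministic _≡_ Opposite
  Opposite-deterministic ((k , x∈k , y∈k) , x≁y , x≢y) ((k′ , x∈k′ , y′∈k′) , x≁y′ , x≢y′) =
    trans (opposite-unique k x∈k y∈k x≁y x≢y) (sym (opposite-unique k x∈k y′∈k x≁y′ x≢y′))
    where
    y′∈k = MemF-transfer k′ k (MemF-same-square k′ k x∈k′ x∈k) y′∈k′

  Opposite-preserved : Preserved Opposite
  Opposite-preserved f (s , x≁y , x≢y) =
    SameSquare-preserved f s , x≁y ∘′ reflected Adj-preserved f , x≢y ∘′ fun-injective f

  Diagonal : Vertex n → Vertex n → Set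
  Diagonal x y = Σ (Fin n) λ i → EvenIx i × ((x ≡ (U , i) × y ≡ (V , i ⊕ 1)) ⊎ (x ≡ (U , i ⊕ 1) × y ≡ (V , i)))

  Diagonal⇒Opposite : ∀ {x y} → Diagonal x y → Opposite x y
  Diagonal⇒Opposite (i , ei , inj₁ (refl , refl)) =
    ((i , ei) , inj₁ refl , inj₂ (inj₂ (inj₁ refl))) ,
    (λ { (inj₁ i⊕1≡i) → aperiodic i (s≤s z≤n) 1<n (sym i⊕1≡i) }) , (λ ())
  Diagonal⇒Opposite (i , ei , inj₂ (refl , refl)) =
    ((i , ei) , inj₂ (inj₁ refl) , inj₂ (inj₂ (inj₂ refl))) ,
    (λ { (inj₁ i≡i⊕1) → aperiodic i (s≤s z≤n) 1<n i≡i⊕1 }) , (λ ())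

  Opposite⇒Diagonal : ∀ {x y} → Opposite x y → Diagonal x y ⊎ Diagonal y x
  Opposite⇒Diagonal {x} ((k , x∈k , y∈k) , x≁y , x≢y) =
    subst (λ z → Diagonal x z ⊎ Diagonal z x) (sym (opposite-unique k x∈k y∈k x≁y x≢y)) (diagonal k x∈k)
    where
    diagonal : ∀ k {x} (x∈k : MemF n k x) → Diagonal x (opposite k x∈k) ⊎ Diagonal (opposite k x∈k) x
    diagonal (i , ei) (inj₁ refl)               = inj₁ (i , ei , inj₁ (refl , refl))
    diagonal (i , ei) (inj₂ (inj₁ refl))        = inj₁ (i , ei , inj₂ (refl , refl))
    diagonal (i , ei) (inj₂ (inj₂ (inj₁ refl))) = inj₂ (i , ei , inj₁ (refl , refl))
    diagonal (i , ei) (inj₂ (inj₂ (inj₂ refl))) = inj₂ (i , ei , inj₂ (refl , refl))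

  Y-split : ∀ {x y} → YAdj n b x y → Green x y ⊎ Opposite x y
  Y-split (inj₁ (inj₁ g)) = inj₁ g
  Y-split (inj₁ (inj₂ d)) = inj₂ (Diagonal⇒Opposite d)
  Y-split (inj₂ (inj₁ g)) = inj₁ (Green-sym g)
  Y-split (inj₂ (inj₂ d)) = inj₂ (Opposite-sym (Diagonal⇒Opposite d))

  Y-join : ∀ {x y} → Green x y ⊎ Opposite x y → YAdj n b x y
  Y-join (inj₁ g) = inj₁ (inj₁ g)
  Y-join (inj₂ o) = ⊎-map inj₂ inj₂ (Opposite⇒Diagonal o)

  Y-preserved : Preserved (YAdj n b)
  Y-preserved f = Y-join ∘′ ⊎-map (Green-preserved f) (Opposite-preserved f) ∘′ Y-split

  A-blockSystem : BlockSystem n 1 b (Vertex n) (MemA n b)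
  A-blockSystem = blockSystem-of-connected Y-preserved (MemA n b) (λ w → w , ε) (λ x → x , ε)
    (λ x—y w⇝x → w⇝x ◅◅ (x—y ◅ ε)) (λ w⇝x w⇝y → reverse ⊎-swap w⇝x ◅◅ w⇝y)

  anchor-chain-fixed : (f : Aut n 1 b) → (w x : Vertex n) → MemA n b w x → Aut.fun f x ≡ x →
    (z : Vertex n) → MemA n b w z → Aut.fun f z ≡ z
  anchor-chain-fixed f w x w⇝x fx z w⇝z = fixed-along-Star Y-preserved f fixed-Y-step fx (reverse ⊎-swap w⇝x ◅◅ w⇝z)
    where
    fixed-Y-step : ∀ {x y} → Aut.fun f x ≡ x → YAdj n b x y → Aut.fun f y ≡ y
    fixed-Y-step fx x—y with Y-split x—y
    ... | inj₁ g = fixed-step Green-preserved Green-deterministic f fx g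
    ... | inj₂ o = fixed-step Opposite-preserved Opposite-deterministic f fx o

lemma6p3 : (n b : ℕ) → ⦃ _ : NonZero n ⦄ →
    4 ≤ n → 2 ∣ n → ¬ (2 ∣ b) → 1 < b → b < n →
    Feasible1 n b → 3 < b →
    BlockSystem n 1 b (Vertex n) (MemA n b) ×
    BlockSystem n 1 b (FIx n) (MemF n) ×
    BlockSystem n 1 b (GreenIx n) (MemM n b) ×
    ((f : Aut n 1 b) → (w x : Vertex n) → MemA n b w x → Aut.fun f x ≡ x →
      (z : Vertex n) → MemA n b w z → Aut.fun f z ≡ z)
lemma6p3 n b 4≤n 2∣n 2∤b _ b<n (gcd≡2 , _ , _ , b∸2<n∸3) 3<b =
  A-blockSystem , F-blockSystem , M-blockSystem , anchor-chain-fixed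
  where
  1≤b : 1 ≤ b
  1≤b = ≤-trans (s≤s z≤n) 3<b

  1+b<n : suc b < n
  1+b<n = m∸2<n∸3⇒1+m<n (≤-trans (s≤s (s≤s z≤n)) (<⇒≤ 3<b)) (≤-trans (s≤s (s≤s (s≤s z≤n))) 4≤n)
                        b∸2<n∸3

  n∤2b∸2 : n ∤ (b + b) ∸ 2
  n∤2b∸2 = subst (n ∤_) (sym ([m+m]∸2≡[m∸1]+[m∸1] 1≤b))
    (gcd≡2⇒n∤d+d gcd≡2 (∸-monoˡ-< 3<b (s≤s z≤n)) (≤-<-trans (m∸n≤m b 1) b<n))

  open MO₁ n b 2∣n 2∤b 3<b 1+b<n n∤2b∸2
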